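{- Let $G = (V, E)$ be a finite simple bipartite graph containing no cycle of length $4$, let $\{A, B\}$ be a bipartition of $V$ (every edge joins a vertex of $A$ to a vertex of $B$), and let $n = |A|$. If $\deg(v) \geq \sqrt{2en}$ for all $v \in A$, where $e$ is the base of the natural logarithm, then $G$ has a matching which saturates $A$, i.e. a matching of size $|A|$ covering every vertex of $A$. -}

module Defs where

open import Data.Nat using (ℕ; zero; suc; _!)
open import Data.Nat.Properties using (_!≢0)
open import Data.Bool using (Bool; true; false; if_then_else_)
open import Data.Fin using (Fin)
open import Data.List using (List; map; allFin)
open import Data.Nat.ListAction using (sum)
open import Data.Integer using (+_)
open import Data.Rational using (ℚ; _+_; _*_; _≤_) renaming (_/_ to _÷_)
open import Relation.Binary.PropositionalEquality using (_≡_; _≢_)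
open import Data.Product using (_×_)

eApprox : ℕ → ℚ
eApprox zero = + 1 ÷ 1
eApprox (suc N) = eApprox N + ((+ 1 ÷ (suc N !)) {{(suc N) !≢0}})

-- DegCond n d : "d ≥ √(2 e n)", i.e. d² ≥ 2 e n, i.e. (since e = sup_N eApprox N)
-- for every N, 2n · eApprox N ≤ d²  (all in ℚ).
DegCond : ℕ → ℕ → Set
DegCond n d = ∀ (N : ℕ) → (+ (2 Data.Nat.* n) ÷ 1) * eApprox N ≤ (+ (d Data.Nat.^ 2) ÷ 1)
  where import Data.Nat

-- A finite simple bipartite graph with parts A = Fin n and B = Fin m,
-- given by its (decidable) adjacency relation between the two parts.
BipGraph : ℕ → ℕ → Set
BipGraph n m = Fin n → Fin m → Bool

degA : ∀ {n m} → BipGraph n m → Fin n → ℕ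
degA {m = m} G a = sum (map (λ b → if G a b then 1 else 0) (allFin m))

C4Free : ∀ {n m} → BipGraph n m → Set
C4Free {n} {m} G = ∀ (a₁ a₂ : Fin n) (b₁ b₂ : Fin m) → a₁ ≢ a₂ → b₁ ≢ b₂ →
  G a₁ b₁ ≡ true → G a₁ b₂ ≡ true → G a₂ b₁ ≡ true → G a₂ b₂ ≡ true → Data.Empty.⊥
  where import Data.Empty

SaturatingMatching : ∀ {n m} → BipGraph n m → Set
SaturatingMatching {n} {m} G =
  Data.Product.Σ (Fin n → Fin m) λ f →
    (∀ a → G a (f a) ≡ true) × (∀ a a' → f a ≡ f a' → a ≡ a')

module Submission where

-- Match the vertices of A one at a time, keeping a matching f of the earlier ones. Let s be the
-- minimum degree, so s² ≥ 2n. If the new vertex a has an unmatched neighbour, use it. Otherwise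
-- every neighbour b of a has a partner j; since G has no 4-cycle, j and a share only b, so j has
-- at least s − 1 neighbours outside N(a), and for different b these sets share at most one vertex.
-- Their union therefore has at least (s − 1) + (s − 2) + … + 0 = s(s − 1)/2 vertices, none in
-- N(a); together with the s vertices of N(a) that exceeds the n − 1 matched vertices. Hence some
-- c in the union is unmatched, and the alternating path a – b – j – c augments f.

open import Defs
open import Data.Bool using (Bool; true; false; _∧_; _∨_; not; if_then_else_)
open import Data.Bool.Properties
  using (∧-conicalˡ; ∧-conicalʳ; ∧-identityʳ; ∧-zeroʳ; ∧-distribˡ-∨; ∨-zeroʳ; ¬-not; not-injective)
  renaming (_≟_ to _≟ᵇ_)
open import Data.Empty using (⊥; ⊥-elim)
open import Data.Fin using (Fin; zero; suc; _≟_)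
open import Data.Fin.Properties using (any?; suc-injective)
open import Data.List using (allFin; tabulate)
open import Data.List.Extrema.Nat using (argmin; f[argmin]≤f[xs])
open import Data.List.Membership.Propositional.Properties using (∈-allFin)
open import Data.List.Properties using (map-tabulate)
open import Data.List.Relation.Unary.All using (lookup)
open import Data.Nat using (ℕ; zero; suc; _+_; _*_; _∸_; _≤_; _<_; z≤n; s≤s)
open import Data.Nat.ListAction using (sum)
open import Data.Nat.Properties hiding (_≟_; suc-injective)
open import Algebra.Properties.CommutativeSemigroup +-commutativeSemigroup using (interchange)
open import Data.Nat.Solver using (module +-*-Solver)
open import Data.Product using (∃; _×_; _,_; proj₁; proj₂)
open import Data.Sum using (_⊎_; inj₁; inj₂)
open import Data.Vec.Functional using (_∷_; updateAt)
open import Data.Vec.Functional.Properties using (updateAt-updates; updateAt-minimal)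
open import Function using (_∘_; const)
open import Relation.Nullary using (yes; no; does; _×-dec_)
open import Relation.Nullary.Decidable using (dec-true)
open import Relation.Binary.PropositionalEquality
open +-*-Solver using (solve; _:+_; _:*_; _:=_; con)
import Data.Integer as ℤ
import Data.Integer.Properties as ℤ
import Data.Nat.Coprimality as Coprimality
import Data.Rational as ℚ
import Data.Rational.Properties as ℚ

infixr 7 _∩_
infixr 6 _∪_ _∖_
infix 4 _⊆_

_∪_ _∩_ _∖_ : ∀ {k} → (Fin k → Bool) → (Fin k → Bool) → Fin k → Bool
(P ∪ Q) x = P x ∨ Q x
(P ∩ Q) x = P x ∧ Q x
(P ∖ Q) x = P x ∧ not (Q x)

_⊆_ : ∀ {k} → (Fin k → Bool) → (Fin k → Bool) → Set
P ⊆ Q = ∀ x → P x ≡ true → Q x ≡ true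

∪-⊆ : ∀ {k} {P Q R : Fin k → Bool} → P ⊆ R → Q ⊆ R → P ∪ Q ⊆ R
∪-⊆ {P = P} P⊆R Q⊆R x x∈ with P x in Px
... | true  = P⊆R x Px
... | false = Q⊆R x x∈

⊆-or-escape : ∀ {k} (P Q : Fin k → Bool) → P ⊆ Q ⊎ ∃ λ x → P x ≡ true × Q x ≡ false
⊆-or-escape P Q with any? (λ x → (P x ≟ᵇ true) ×-dec (Q x ≟ᵇ false))
... | yes escape = inj₂ escape
... | no ¬escape = inj₁ λ x Px → ¬-not (λ Qx → ¬escape (x , Px , Qx))

some : ∀ {k} → (Fin k → Bool) → Bool
some {zero}  P = false
some {suc k} P = P zero ∨ some (P ∘ suc)

some-intro : ∀ {k} (P : Fin k → Bool) x → P x ≡ true → some P ≡ true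
some-intro P zero    Px rewrite Px = refl
some-intro P (suc x) Px rewrite some-intro (P ∘ suc) x Px = ∨-zeroʳ (P zero)

some-elim : ∀ {k} (P : Fin k → Bool) → some P ≡ true → ∃ λ x → P x ≡ true
some-elim {suc k} P some≡true with P zero in P0
... | true  = zero , P0
... | false = let x , Px = some-elim (P ∘ suc) some≡true in suc x , Px

⋃ : ∀ {k m} → (Fin k → Bool) → (Fin k → Fin m → Bool) → Fin m → Bool
⋃ I T c = some (λ i → I i ∧ T i c)

_≡ᶠ_ : ∀ {k} → Fin k → Fin k → Bool
x ≡ᶠ y = does (x ≟ y)

≡ᶠ-refl : ∀ {k} (x : Fin k) → x ≡ᶠ x ≡ true
≡ᶠ-refl x = dec-true (x ≟ x) refl

≡ᶠ⇒≡ : ∀ {k} {x y : Fin k} → x ≡ᶠ y ≡ true → x ≡ y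
≡ᶠ⇒≡ {x = x} {y} _ with x ≟ y
... | yes x≡y = x≡y

image : ∀ {k m} → (Fin k → Fin m) → Fin m → Bool
image f c = some (λ i → f i ≡ᶠ c)

image-intro : ∀ {k m} (f : Fin k → Fin m) i → image f (f i) ≡ true
image-intro f i = some-intro _ i (≡ᶠ-refl (f i))

image-elim : ∀ {k m} (f : Fin k → Fin m) {c} → image f c ≡ true → ∃ λ i → f i ≡ c
image-elim f c∈im = let i , fi≟c = some-elim _ c∈im in i , ≡ᶠ⇒≡ fi≟c

count : ∀ {k} → (Fin k → Bool) → ℕ
count {zero}  P = 0
count {suc k} P = (if P zero then 1 else 0) + count (P ∘ suc)

degA≡count : ∀ {n m} (G : BipGraph n m) a → degA G a ≡ count (G a)
degA≡count G a = trans (cong sum (map-tabulate (λ b → b) (λ b → if G a b then 1 else 0))) (sum-tabulate (G a))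
  where
  sum-tabulate : ∀ {k} (P : Fin k → Bool) → sum (tabulate (λ b → if P b then 1 else 0)) ≡ count P
  sum-tabulate {zero}  P = refl
  sum-tabulate {suc k} P = cong ((if P zero then 1 else 0) +_) (sum-tabulate (P ∘ suc))

count-mono : ∀ {k} {P Q : Fin k → Bool} → P ⊆ Q → count P ≤ count Q
count-mono {zero}          P⊆Q = z≤n
count-mono {suc k} {P} {Q} P⊆Q = +-mono-≤ head (count-mono (P⊆Q ∘ suc))
  where
  head : (if P zero then 1 else 0) ≤ (if Q zero then 1 else 0)
  head with P zero in P0
  ... | false = z≤n
  ... | true rewrite P⊆Q zero P0 = ≤-refl

count-∅ : ∀ {k} (P : Fin k → Bool) → (∀ x → P x ≡ false) → count P ≡ 0
count-∅ {zero}  P P≡∅ = refl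
count-∅ {suc k} P P≡∅ rewrite P≡∅ zero = count-∅ (P ∘ suc) (P≡∅ ∘ suc)

count-∪-∩ : ∀ {k} (P Q : Fin k → Bool) → count (P ∪ Q) + count (P ∩ Q) ≡ count P + count Q
count-∪-∩ {zero}  P Q = refl
count-∪-∩ {suc k} P Q = begin
  (ι (P zero ∨ Q zero) + count ((P ∪ Q) ∘ suc)) + (ι (P zero ∧ Q zero) + count ((P ∩ Q) ∘ suc))
    ≡⟨ interchange (ι (P zero ∨ Q zero)) _ (ι (P zero ∧ Q zero)) _ ⟩
  (ι (P zero ∨ Q zero) + ι (P zero ∧ Q zero)) + (count ((P ∪ Q) ∘ suc) + count ((P ∩ Q) ∘ suc))
    ≡⟨ cong₂ _+_ (head (P zero) (Q zero)) (count-∪-∩ (P ∘ suc) (Q ∘ suc)) ⟩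
  (ι (P zero) + ι (Q zero)) + (count (P ∘ suc) + count (Q ∘ suc))
    ≡⟨ interchange (ι (P zero)) (ι (Q zero)) (count (P ∘ suc)) _ ⟩
  (ι (P zero) + count (P ∘ suc)) + (ι (Q zero) + count (Q ∘ suc)) ∎
  where
  open ≡-Reasoning
  ι : Bool → ℕ
  ι b = if b then 1 else 0
  head : ∀ p q → ι (p ∨ q) + ι (p ∧ q) ≡ ι p + ι q
  head true  true  = refl
  head true  false = refl
  head false true  = refl
  head false false = refl

count-∪ : ∀ {k} (P Q : Fin k → Bool) → count (P ∪ Q) ≤ count P + count Q
count-∪ P Q = ≤-trans (m≤m+n _ _) (≤-reflexive (count-∪-∩ P Q))

count-∪-disjoint : ∀ {k} (P Q : Fin k → Bool) → (∀ x → Q x ≡ true → P x ≡ false) →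
  count (P ∪ Q) ≡ count P + count Q
count-∪-disjoint P Q disjoint = begin
  count (P ∪ Q)                  ≡⟨ +-identityʳ _ ⟨
  count (P ∪ Q) + 0              ≡⟨ cong (count (P ∪ Q) +_) (count-∅ (P ∩ Q) P∩Q≡∅) ⟨
  count (P ∪ Q) + count (P ∩ Q)  ≡⟨ count-∪-∩ P Q ⟩
  count P + count Q              ∎
  where
  open ≡-Reasoning
  P∩Q≡∅ : ∀ x → P x ∧ Q x ≡ false
  P∩Q≡∅ x with Q x in Qx
  ... | false = ∧-zeroʳ (P x)
  ... | true rewrite disjoint x Qx = refl

count-≤1 : ∀ {k} (P : Fin k → Bool) → (∀ x y → P x ≡ true → P y ≡ true → x ≡ y) → count P ≤ 1
count-≤1 {zero}  P unique = z≤n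
count-≤1 {suc k} P unique with P zero in P0
... | true  = ≤-reflexive (cong suc (count-∅ (P ∘ suc) rest-empty))
  where
  rest-empty : ∀ x → P (suc x) ≡ false
  rest-empty x with P (suc x) in Px
  ... | false = refl
  ... | true with () ← unique zero (suc x) P0 Px
... | false = count-≤1 (P ∘ suc) λ x y Px Py → suc-injective (unique (suc x) (suc y) Px Py)

count-image : ∀ {k m} (f : Fin k → Fin m) → count (image f) ≤ k
count-image {zero}  f = ≤-reflexive (count-∅ (image f) (λ _ → refl))
count-image {suc k} f =
  ≤-trans (count-∪ (f zero ≡ᶠ_) (image (f ∘ suc))) (+-mono-≤ singleton (count-image (f ∘ suc)))
  where
  singleton : count (f zero ≡ᶠ_) ≤ 1
  singleton = count-≤1 (f zero ≡ᶠ_) λ x y f₀≡x f₀≡y →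
    trans (sym (≡ᶠ⇒≡ {x = f zero} f₀≡x)) (≡ᶠ⇒≡ {x = f zero} f₀≡y)

staircase : ℕ → ℕ → ℕ
staircase t zero    = 0
staircase t (suc K) = staircase t K + (t ∸ K)

staircase-mono : ∀ t {K K′} → K ≤ K′ → staircase t K ≤ staircase t K′
staircase-mono t {K′ = zero}   z≤n = ≤-refl
staircase-mono t {K′ = suc K′} K≤1+K′ with m≤n⇒m<n∨m≡n K≤1+K′
... | inj₁ (s≤s K≤K′) = ≤-trans (staircase-mono t K≤K′) (m≤m+n _ _)
... | inj₂ refl       = ≤-refl

staircase-triangular : ∀ r K → 2 * staircase (r + K) K ≡ K * (2 * r + suc K)
staircase-triangular r zero    = refl
staircase-triangular r (suc K) = begin
  2 * (staircase (r + suc K) K + (r + suc K ∸ K))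
    ≡⟨ cong (λ t → 2 * (staircase t K + (t ∸ K))) (+-suc r K) ⟩
  2 * (staircase (suc r + K) K + (suc r + K ∸ K))
    ≡⟨ cong (λ d → 2 * (staircase (suc r + K) K + d)) (m+n∸n≡m (suc r) K) ⟩
  2 * (staircase (suc r + K) K + suc r)
    ≡⟨ *-distribˡ-+ 2 (staircase (suc r + K) K) (suc r) ⟩
  2 * staircase (suc r + K) K + 2 * suc r
    ≡⟨ cong (_+ 2 * suc r) (staircase-triangular (suc r) K) ⟩
  K * (2 * suc r + suc K) + 2 * suc r
    ≡⟨ solve 2 (λ r K → K :* (con 2 :* (con 1 :+ r) :+ (con 1 :+ K)) :+ con 2 :* (con 1 :+ r)
                     := (con 1 :+ K) :* (con 2 :* r :+ (con 2 :+ K))) refl r K ⟩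
  suc K * (2 * r + suc (suc K)) ∎
  where open ≡-Reasoning

n<s+staircase : ∀ {n} s → 2 * suc n ≤ s * s → n < s + staircase (s ∸ 1) (s ∸ 1)
n<s+staircase zero    ()
n<s+staircase {n} (suc t) 2[1+n]≤s² = *-cancelˡ-< 2 n _ (begin-strict
  2 * n                            <⟨ *-monoʳ-< 2 (n<1+n n) ⟩
  2 * suc n                        ≤⟨ 2[1+n]≤s² ⟩
  suc t * suc t                    ≤⟨ *-monoʳ-≤ (suc t) (n≤1+n (suc t)) ⟩
  suc t * suc (suc t)              ≡⟨ solve 1 (λ t → (con 1 :+ t) :* (con 2 :+ t)
                                                  := con 2 :* (con 1 :+ t) :+ t :* (con 1 :+ t)) refl t ⟩
  2 * suc t + t * suc t            ≡⟨ cong (2 * suc t +_) (staircase-triangular 0 t) ⟨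
  2 * suc t + 2 * staircase t t    ≡⟨ *-distribˡ-+ 2 (suc t) (staircase t t) ⟨
  2 * (suc t + staircase t t)      ∎)
  where open ≤-Reasoning

count-∩-⋃ : ∀ {k m} (P : Fin m → Bool) (I : Fin k → Bool) (T : Fin k → Fin m → Bool) →
  (∀ i → count (P ∩ T i) ≤ 1) → count (P ∩ ⋃ I T) ≤ count I
count-∩-⋃ {zero}  P I T small = ≤-reflexive (count-∅ (P ∩ ⋃ I T) (λ c → ∧-zeroʳ (P c)))
count-∩-⋃ {suc k} P I T small = begin
  count (P ∩ ⋃ I T)                          ≤⟨ count-mono distrib ⟩
  count (P ∩ T₀ ∪ P ∩ ⋃ (I ∘ suc) (T ∘ suc)) ≤⟨ count-∪ (P ∩ T₀) _ ⟩
  count (P ∩ T₀) + count (P ∩ ⋃ (I ∘ suc) (T ∘ suc))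
    ≤⟨ +-mono-≤ (first (I zero)) (count-∩-⋃ P (I ∘ suc) (T ∘ suc) (small ∘ suc)) ⟩
  count I                                    ∎
  where
  open ≤-Reasoning
  T₀ : Fin _ → Bool
  T₀ c = I zero ∧ T zero c
  distrib : P ∩ ⋃ I T ⊆ P ∩ T₀ ∪ P ∩ ⋃ (I ∘ suc) (T ∘ suc)
  distrib c = subst (_≡ true) (∧-distribˡ-∨ (P c) (T₀ c) _)
  first : ∀ b → count (P ∩ (λ c → b ∧ T zero c)) ≤ (if b then 1 else 0)
  first true  = small zero
  first false = ≤-reflexive (count-∅ _ (λ c → ∧-zeroʳ (P c)))

staircase≤count-⋃ : ∀ {k m} t (I : Fin k → Bool) (T : Fin k → Fin m → Bool) →
  (∀ i → I i ≡ true → t ≤ count (T i)) →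
  (∀ i j → i ≢ j → count (T i ∩ T j) ≤ 1) →
  staircase t (count I) ≤ count (⋃ I T)
staircase≤count-⋃ {zero}  t I T large sparse = z≤n
staircase≤count-⋃ {suc k} t I T large sparse = step (I zero) (large zero)
  where
  K = count (I ∘ suc)
  U = ⋃ (I ∘ suc) (T ∘ suc)
  U-large : staircase t K ≤ count U
  U-large = staircase≤count-⋃ t (I ∘ suc) (T ∘ suc) (large ∘ suc)
              (λ i j i≢j → sparse (suc i) (suc j) (i≢j ∘ suc-injective))
  step : ∀ b → (b ≡ true → t ≤ count (T zero)) →
         staircase t ((if b then 1 else 0) + K) ≤ count ((λ c → b ∧ T zero c) ∪ U)
  step false _     = U-large
  step true  large₀ = +-cancelʳ-≤ y _ _ (begin
    staircase t K + (t ∸ K) + y             ≤⟨ +-monoˡ-≤ y (+-mono-≤ U-large (∸-mono (large₀ refl) y≤K)) ⟩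
    count U + (count (T zero) ∸ y) + y      ≡⟨ +-assoc (count U) _ y ⟩
    count U + (count (T zero) ∸ y + y)      ≡⟨ cong (count U +_) (m∸n+n≡m y≤T₀) ⟩
    count U + count (T zero)                ≡⟨ +-comm (count U) _ ⟩
    count (T zero) + count U                ≡⟨ count-∪-∩ (T zero) U ⟨
    count (T zero ∪ U) + y                  ∎)
    where
    open ≤-Reasoning
    y = count (T zero ∩ U)
    y≤K : y ≤ K
    y≤K = count-∩-⋃ (T zero) (I ∘ suc) (T ∘ suc) (λ i → sparse zero (suc i) λ ())
    y≤T₀ : y ≤ count (T zero)
    y≤T₀ = count-mono {P = T zero ∩ U} (λ c → ∧-conicalˡ _ _)

common-neighbours≤1 : ∀ {n m} {G : BipGraph n m} → C4Free G →
  ∀ {a a′} → a ≢ a′ → count (G a ∩ G a′) ≤ 1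
common-neighbours≤1 {G = G} c4 {a} {a′} a≢a′ = count-≤1 (G a ∩ G a′) unique
  where
  unique : ∀ x y → (G a ∩ G a′) x ≡ true → (G a ∩ G a′) y ≡ true → x ≡ y
  unique x y x∈ y∈ with x ≟ y
  ... | yes x≡y = x≡y
  ... | no  x≢y = ⊥-elim (c4 a a′ x y a≢a′ x≢y (∧-conicalˡ _ _ x∈) (∧-conicalˡ _ _ y∈)
                                               (∧-conicalʳ _ _ x∈) (∧-conicalʳ _ _ y∈))

C4Free-tail : ∀ {n m} {G : BipGraph (suc n) m} → C4Free G → C4Free (G ∘ suc)
C4Free-tail c4 a₁ a₂ b₁ b₂ a₁≢a₂ = c4 (suc a₁) (suc a₂) b₁ b₂ (a₁≢a₂ ∘ suc-injective)

consMatching : ∀ {n m} (G : BipGraph (suc n) m) (μ : SaturatingMatching (G ∘ suc)) {b} →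
  G zero b ≡ true → (∀ i → proj₁ μ i ≢ b) → SaturatingMatching G
consMatching G (f , adj , inj) {b} adj₀ fresh = b ∷ f , adj′ , inj′
  where
  adj′ : ∀ a → G a ((b ∷ f) a) ≡ true
  adj′ zero    = adj₀
  adj′ (suc i) = adj i
  inj′ : ∀ a a′ → (b ∷ f) a ≡ (b ∷ f) a′ → a ≡ a′
  inj′ zero    zero     _  = refl
  inj′ zero    (suc i′) eq = ⊥-elim (fresh i′ (sym eq))
  inj′ (suc i) zero     eq = ⊥-elim (fresh i eq)
  inj′ (suc i) (suc i′) eq = cong suc (inj i i′ eq)

updateAt-const : ∀ {A : Set} {n} (f : Fin n → A) j {c} a →
  (a ≡ j × updateAt f j (const c) a ≡ c) ⊎ (a ≢ j × updateAt f j (const c) a ≡ f a)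
updateAt-const f j a with a ≟ j
... | yes refl = inj₁ (refl , updateAt-updates j f)
... | no  a≢j  = inj₂ (a≢j , updateAt-minimal a j f a≢j)

reassign : ∀ {n m} (G : BipGraph n m) (μ : SaturatingMatching G) j {c} →
  G j c ≡ true → (∀ i → proj₁ μ i ≢ c) → SaturatingMatching G
reassign G (f , adj , inj) j {c} adjⱼ fresh = g , adj′ , inj′
  where
  g = updateAt f j (const c)
  adj′ : ∀ a → G a (g a) ≡ true
  adj′ a with updateAt-const f j a
  ... | inj₁ (refl , ga≡c) = subst (λ x → G j x ≡ true) (sym ga≡c) adjⱼ
  ... | inj₂ (_ , ga≡fa)   = subst (λ x → G a x ≡ true) (sym ga≡fa) (adj a)
  inj′ : ∀ a a′ → g a ≡ g a′ → a ≡ a′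
  inj′ a a′ eq with updateAt-const f j a | updateAt-const f j a′
  ... | inj₁ (refl , _)  | inj₁ (refl , _)    = refl
  ... | inj₁ (_ , ga≡c)  | inj₂ (_ , ga′≡fa′) = ⊥-elim (fresh a′ (trans (sym ga′≡fa′) (trans (sym eq) ga≡c)))
  ... | inj₂ (_ , ga≡fa) | inj₁ (_ , ga′≡c)   = ⊥-elim (fresh a (trans (sym ga≡fa) (trans eq ga′≡c)))
  ... | inj₂ (_ , ga≡fa) | inj₂ (_ , ga′≡fa′) = inj a a′ (trans (sym ga≡fa) (trans eq ga′≡fa′))

module _ {n m} (G : BipGraph (suc n) m) (c4 : C4Free G) (s : ℕ)
         (deg≥s : ∀ a → s ≤ count (G a)) (2[1+n]≤s² : 2 * suc n ≤ s * s)
         (μ : SaturatingMatching (G ∘ suc)) where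

  private
    f : Fin n → Fin m
    f = proj₁ μ

    f-inj : ∀ i i′ → f i ≡ f i′ → i ≡ i′
    f-inj = proj₂ (proj₂ μ)

    unmatched : ∀ {c} → image f c ≡ false → ∀ i → f i ≢ c
    unmatched c∉im i refl with () ← trans (sym (image-intro f i)) c∉im

    partnerNbhd : Fin m → Fin m → Bool
    partnerNbhd b = ⋃ (λ j → f j ≡ᶠ b) (G ∘ suc)

    partnerNbhd-intro : ∀ {j c} → G (suc j) c ≡ true → partnerNbhd (f j) c ≡ true
    partnerNbhd-intro {j} {c} adj =
      some-intro _ j (trans (cong (_∧ G (suc j) c) (≡ᶠ-refl (f j))) adj)

    -- reach b c: an alternating path leads from the new vertex zero through b and its partner to c.
    reach : Fin m → Fin m → Bool
    reach b = partnerNbhd b ∖ G zero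

    reach-elim : ∀ {b c} → reach b c ≡ true →
                 ∃ λ j → f j ≡ b × G (suc j) c ≡ true × G zero c ≡ false
    reach-elim c∈ with some-elim _ (∧-conicalˡ _ _ c∈)
    ... | j , path =
      j , ≡ᶠ⇒≡ (∧-conicalˡ _ _ path) , ∧-conicalʳ _ _ path , not-injective (∧-conicalʳ _ _ c∈)

    reach-large : ∀ j → s ∸ 1 ≤ count (reach (f j))
    reach-large j = ∸-monoˡ-≤ 1 (begin
      s                                               ≤⟨ deg≥s (suc j) ⟩
      count (G (suc j))                               ≤⟨ count-mono split ⟩
      count (G (suc j) ∩ G zero ∪ reach (f j))        ≤⟨ count-∪ (G (suc j) ∩ G zero) _ ⟩
      count (G (suc j) ∩ G zero) + count (reach (f j)) ≤⟨ +-monoˡ-≤ _ (common-neighbours≤1 c4 λ ()) ⟩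
      1 + count (reach (f j))                         ∎)
      where
      open ≤-Reasoning
      split : G (suc j) ⊆ G (suc j) ∩ G zero ∪ reach (f j)
      split c adj with G zero c
      ... | true  rewrite adj = refl
      ... | false rewrite adj = trans (∧-identityʳ _) (partnerNbhd-intro adj)

    reach-sparse : ∀ b b′ → b ≢ b′ → count (reach b ∩ reach b′) ≤ 1
    reach-sparse b b′ b≢b′ = count-≤1 (reach b ∩ reach b′) unique
      where
      unique : ∀ x y → (reach b ∩ reach b′) x ≡ true → (reach b ∩ reach b′) y ≡ true → x ≡ y
      unique x y x∈ y∈
        with reach-elim (∧-conicalˡ (reach b x) _ x∈) | reach-elim (∧-conicalʳ (reach b x) _ x∈)
           | reach-elim (∧-conicalˡ (reach b y) _ y∈) | reach-elim (∧-conicalʳ (reach b y) _ y∈)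
      ... | j , fj≡b , jx , _ | k , fk≡b′ , kx , _ | j′ , fj′≡b , j′y , _ | k′ , fk′≡b′ , k′y , _
        with f-inj j′ j (trans fj′≡b (sym fj≡b)) | f-inj k′ k (trans fk′≡b′ (sym fk≡b′)) | x ≟ y
      ... | refl | refl | yes x≡y = x≡y
      ... | refl | refl | no  x≢y =
        ⊥-elim (c4 (suc j) (suc k) x y j≢k x≢y jx j′y kx k′y)
        where
        j≢k : suc j ≢ suc k
        j≢k j≡k = b≢b′ (trans (sym fj≡b) (trans (cong f (suc-injective j≡k)) fk≡b′))

    stuck-impossible : G zero ⊆ image f → ⋃ (G zero) reach ⊆ image f → ⊥
    stuck-impossible N⊆im U⊆im = <-irrefl refl (begin-strict
      n                              <⟨ n<s+staircase s 2[1+n]≤s² ⟩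
      s + staircase (s ∸ 1) (s ∸ 1)  ≤⟨ +-mono-≤ (deg≥s zero) U-large ⟩
      count N + count U              ≡⟨ count-∪-disjoint N U U∩N≡∅ ⟨
      count (N ∪ U)                  ≤⟨ count-mono (∪-⊆ N⊆im U⊆im) ⟩
      count (image f)                ≤⟨ count-image f ⟩
      n                              ∎)
      where
      open ≤-Reasoning
      N = G zero
      U = ⋃ N reach
      neighbour-reach-large : ∀ b → N b ≡ true → s ∸ 1 ≤ count (reach b)
      neighbour-reach-large b Nb with image-elim f (N⊆im b Nb)
      ... | j , refl = reach-large j
      U-large : staircase (s ∸ 1) (s ∸ 1) ≤ count U
      U-large = ≤-trans (staircase-mono (s ∸ 1) (≤-trans (m∸n≤m s 1) (deg≥s zero)))
                        (staircase≤count-⋃ (s ∸ 1) N reach neighbour-reach-large reach-sparse)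
      U∩N≡∅ : ∀ c → U c ≡ true → N c ≡ false
      U∩N≡∅ c c∈U with some-elim (λ b → N b ∧ reach b c) c∈U
      ... | b , c∈reach = let _ , _ , _ , non-adj = reach-elim (∧-conicalʳ (N b) _ c∈reach) in non-adj

    -- The alternating path zero – b – suc j – c ends at an unmatched vertex, so it augments μ.
    augment-through : ∀ {c} → ⋃ (G zero) reach c ≡ true → image f c ≡ false → SaturatingMatching G
    augment-through {c} c∈U c∉im with some-elim (λ b → G zero b ∧ reach b c) c∈U
    ... | b , c∈reach with reach-elim (∧-conicalʳ (G zero b) _ c∈reach)
    ... | j , fj≡b , adjⱼ , non-adj =
      consMatching G (reassign (G ∘ suc) μ j adjⱼ (unmatched c∉im)) adj b-fresh
      where
      adj : G zero b ≡ true
      adj = ∧-conicalˡ (G zero b) _ c∈reach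
      b-fresh : ∀ i → updateAt f j (const c) i ≢ b
      b-fresh i gi≡b with updateAt-const f j i
      ... | inj₁ (_ , gi≡c)
        with () ← trans (sym non-adj) (subst (λ x → G zero x ≡ true) (trans (sym gi≡b) gi≡c) adj)
      ... | inj₂ (i≢j , gi≡fi) = i≢j (f-inj i j (trans (sym gi≡fi) (trans gi≡b (sym fj≡b))))

  augment : SaturatingMatching G
  augment with ⊆-or-escape (G zero) (image f)
  ... | inj₂ (b , adj , b∉im) = consMatching G μ adj (unmatched b∉im)
  ... | inj₁ N⊆im with ⊆-or-escape (⋃ (G zero) reach) (image f)
  ...   | inj₁ U⊆im             = ⊥-elim (stuck-impossible N⊆im U⊆im)
  ...   | inj₂ (c , c∈U , c∉im) = augment-through c∈U c∉im

saturatingMatching : ∀ s {n m} (G : BipGraph n m) → C4Free G →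
  (∀ a → s ≤ count (G a)) → 2 * n ≤ s * s → SaturatingMatching G
saturatingMatching s {zero}  G c4 deg≥s 2n≤s² = (λ ()) , (λ ()) , (λ ())
saturatingMatching s {suc n} G c4 deg≥s 2n≤s² =
  augment G c4 s deg≥s 2n≤s² (saturatingMatching s (G ∘ suc) (C4Free-tail c4) (deg≥s ∘ suc) 2n′≤s²)
  where
  2n′≤s² : 2 * n ≤ s * s
  2n′≤s² = ≤-trans (*-monoʳ-≤ 2 (n≤1+n n)) 2n≤s²

ℕ/1-cancel-≤ : ∀ {k l} → ℤ.+ k ℚ./ 1 ℚ.≤ ℤ.+ l ℚ./ 1 → k ≤ l
ℕ/1-cancel-≤ {k} {l} k≤l
  rewrite ℚ.normalize-coprime (Coprimality.sym (Coprimality.1-coprimeTo k))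
        | ℚ.normalize-coprime (Coprimality.sym (Coprimality.1-coprimeTo l))
  = ℤ.drop‿+≤+ (subst₂ ℤ._≤_ (ℤ.*-identityʳ _) (ℤ.*-identityʳ _) (ℚ.drop-*≤* k≤l))

-- Only the first partial sum of e (namely 1) is needed.
degCond⇒2n≤d² : ∀ {n d} → DegCond n d → 2 * n ≤ d * d
degCond⇒2n≤d² {n} {d} degCond =
  subst (2 * n ≤_) (cong (d *_) (*-identityʳ d))
    (ℕ/1-cancel-≤ (subst (ℚ._≤ _) (ℚ.*-identityʳ _) (degCond 0)))

mainTheorem2 : ∀ (n m : ℕ) (G : BipGraph n m) → C4Free G →
    (∀ (a : Fin n) → DegCond n (degA G a)) →
    SaturatingMatching G
mainTheorem2 zero    m G c4 degCond = (λ ()) , (λ ()) , (λ ())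
mainTheorem2 (suc n) m G c4 degCond =
  saturatingMatching (degree a₀) G c4 a₀-minimal
    (subst (λ d → 2 * suc n ≤ d * d) (degA≡count G a₀)
      (degCond⇒2n≤d² {suc n} {degA G a₀} (degCond a₀)))
  where
  degree : Fin (suc n) → ℕ
  degree = count ∘ G
  a₀ = argmin degree zero (allFin (suc n))
  a₀-minimal : ∀ a → degree a₀ ≤ degree a
  a₀-minimal a = lookup (f[argmin]≤f[xs] {f = degree} zero (allFin (suc n))) (∈-allFin a)
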